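{- Let $n\geq 4$ be an integer and let $\mathcal{H}_{2n}$ be the collection of those subsets of $\{1,\dots,2n\}$ that are of the form $\{1,2,2k-1,2k\}$ or $\{2k-1,2k,2k+1,2k+2\}$ for some integer $2\le k\le n$. Then the collection of all $4$-element subsets $B\subset\{1,\dots,2n\}$ with $B\notin\mathcal{H}_{2n}$ is the set of bases of a matroid on $\{1,\dots,2n\}$ (of rank four).
   Context: This matroid is called the $2n$-Vámos matroid $V_{2n}$; for $n=4$ it is the Vámos matroid. -}

module Defs where
open import Data.Nat using (ℕ; suc; _+_; _*_; _∸_; _≤_)
open import Data.Fin using (Fin; toℕ)
open import Data.Fin.Subset using (Subset; _∈_; _∉_; _∪_; _-_; ⁅_⁆; ∣_∣)
open import Data.List using (List; []; _∷_)
open import Data.List.Membership.Propositional using () renaming (_∈_ to _∈ₗ_)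
open import Data.Product using (Σ; ∃; ∃-syntax; _×_; _,_)
open import Data.Sum using (_⊎_)
open import Function.Bundles using (_⇔_)
open import Relation.Nullary using (¬_)
open import Relation.Binary.PropositionalEquality using (_≡_)

IsMatroidBases : {m : ℕ} → (Subset m → Set) → Set
IsMatroidBases {m} 𝓑 =
  (∃[ B ] 𝓑 B) ×
  (∀ (B₁ B₂ : Subset m) (x : Fin m) → 𝓑 B₁ → 𝓑 B₂ → x ∈ B₁ → x ∉ B₂ →
     ∃[ y ] (y ∈ B₂ × y ∉ B₁ × 𝓑 ((B₁ - x) ∪ ⁅ y ⁆)))

-- The element i : Fin (2n) represents the label toℕ i + 1 ∈ {1,…,2n}.
label : {m : ℕ} → Fin m → ℕ
label i = suc (toℕ i)

HasLabels : {m : ℕ} → Subset m → List ℕ → Set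
HasLabels B S = ∀ x → (x ∈ B) ⇔ (label x ∈ₗ S)

InH : (n : ℕ) → Subset (2 * n) → Set
InH n B = ∃[ k ] (2 ≤ k × k ≤ n ×
  ( HasLabels B (1 ∷ 2 ∷ (2 * k ∸ 1) ∷ (2 * k) ∷ [])
  ⊎ (2 * k + 2 ≤ 2 * n × HasLabels B ((2 * k ∸ 1) ∷ (2 * k) ∷ (2 * k + 1) ∷ (2 * k + 2) ∷ []))))

VamosBases : (n : ℕ) → Subset (2 * n) → Set
VamosBases n B = ∣ B ∣ ≡ 4 × ¬ InH n B

module Submission where

-- Call an r-subset family 𝓗 *separated* when no two of its
-- members differ by exchanging a single element.  For such a family the
-- r-sets outside 𝓗 satisfy basis exchange (these are the sparse paving
-- matroids): from bases B₁, B₂ and x ∈ B₁ ∖ B₂, put A = B₁ ∖ {x}; if B₂ ∖ B₁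
-- is a single element y then A ∪ {y} = B₂ is a basis, and otherwise two
-- candidates A ∪ {y₁}, A ∪ {y₂} exist of which at most one lies in 𝓗.
-- To keep the case split constructive we only require 𝓗 to be contained in
-- a decidable separated family 𝓒.
--
-- For V_{2n} take 𝓒 = the sets closed under the fixed-point-free involution
-- pairing the labels 2i-1 and 2i.  Every member of 𝓗_{2n} is a union of two
-- such pairs, hence closed, and closed sets are separated: exchanging a
-- single element always breaks the pair of the element removed.  Finally
-- {1,2,3,5} is a 4-set that is not closed, so bases exist.

open import Defs
open import Data.Nat using (ℕ; zero; suc; _+_; _*_; _∸_; _≤_; _<_; z≤n; s≤s; _≟_)
open import Data.Nat.Properties
  using (suc-injective; +-suc; +-comm; +-identityʳ; ≤-trans; ≤-pred; ≤-reflexive; 1+n≰n; ≤⇒≯; *-monoʳ-≤)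
open import Data.Fin using (Fin; toℕ; fromℕ<)
open import Data.Fin.Properties using (all?; any?; toℕ<n; toℕ-fromℕ<) renaming (_≟_ to _≟ᶠ_)
open import Data.Fin.Subset using (Subset; _∈_; _∉_; _∪_; _-_; ⁅_⁆; ∣_∣; _⊆_; inside; outside; ⊥)
open import Data.Fin.Subset.Properties
  using (_∈?_; x∈p∪q⁻; x∈p∪q⁺; x∈⁅x⁆; x∈⁅y⁆⇒x≡y; x∈p∧x≢y⇒x∈p-y; p─q⊆p; p─⊥≡p; ∪-identityʳ;
         ⊆-antisym; p⊆q⇒∣p∣≤∣q∣; p⊂q⇒∣p∣<∣q∣; ∣⊥∣≡0)
open import Data.Vec using (_∷_; here; there)
open import Data.List using (List; []; _∷_)
open import Data.List.Membership.Propositional using () renaming (_∈_ to _∈ₗ_)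
open import Data.List.Relation.Unary.Any using (here; there)
open import Data.Product using (∃; ∃-syntax; _×_; _,_)
open import Data.Sum using (inj₁; inj₂)
open import Function.Bundles using (Equivalence)
open import Relation.Nullary using (¬_; Dec; yes; no; contradiction)
open import Relation.Nullary.Decidable using (_×-dec_; _→-dec_; ¬?)
open import Relation.Binary.PropositionalEquality using (_≡_; _≢_; refl; sym; trans; cong; cong₂; subst)

∣p-x∣ : ∀ {m} (p : Subset m) {x} → x ∈ p → suc ∣ p - x ∣ ≡ ∣ p ∣
∣p-x∣ (inside  ∷ p) here      = cong (λ t → suc ∣ t ∣) (p─⊥≡p p)
∣p-x∣ (inside  ∷ p) (there h) = cong suc (∣p-x∣ p h)
∣p-x∣ (outside ∷ p) (there h) = ∣p-x∣ p h

∣p∪y∣ : ∀ {m} (p : Subset m) y → y ∉ p → ∣ p ∪ ⁅ y ⁆ ∣ ≡ suc ∣ p ∣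
∣p∪y∣ (inside  ∷ p) Fin.zero    y∉p = contradiction here y∉p
∣p∪y∣ (outside ∷ p) Fin.zero    y∉p = cong (λ t → suc ∣ t ∣) (∪-identityʳ p)
∣p∪y∣ (inside  ∷ p) (Fin.suc y) y∉p = cong suc (∣p∪y∣ p y (λ h → y∉p (there h)))
∣p∪y∣ (outside ∷ p) (Fin.suc y) y∉p = ∣p∪y∣ p y (λ h → y∉p (there h))

⊆∧∣≥∣⇒≡ : ∀ {m} {p q : Subset m} → p ⊆ q → ∣ q ∣ ≤ ∣ p ∣ → p ≡ q
⊆∧∣≥∣⇒≡ {p = p} {q} p⊆q ∣q∣≤∣p∣ = ⊆-antisym p⊆q q⊆p
  where
  q⊆p : q ⊆ p
  q⊆p {w} w∈q with w ∈? p
  ... | yes w∈p = w∈p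
  ... | no  w∉p = contradiction (p⊂q⇒∣p∣<∣q∣ (p⊆q , w , w∈q , w∉p)) (≤⇒≯ ∣q∣≤∣p∣)

module SparsePaving {m : ℕ} (𝓗 𝓒 : Subset m → Set)
  (𝓒? : ∀ S → Dec (𝓒 S))
  (𝓗⇒𝓒 : ∀ {S} → 𝓗 S → 𝓒 S)
  (𝓒-separated : ∀ A {y₁ y₂} → y₁ ∉ A → 𝓒 (A ∪ ⁅ y₁ ⁆) → 𝓒 (A ∪ ⁅ y₂ ⁆) → y₁ ≡ y₂)
  where

  Bases : ℕ → Subset m → Set
  Bases r B = ∣ B ∣ ≡ r × ¬ 𝓗 B

  module Exchange {r : ℕ} {B₁ B₂ : Subset m} {x : Fin m}
    (∣B₁∣≡r : ∣ B₁ ∣ ≡ r) (∣B₂∣≡r : ∣ B₂ ∣ ≡ r) (B₂∉𝓗 : ¬ 𝓗 B₂)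
    (x∈B₁ : x ∈ B₁) (x∉B₂ : x ∉ B₂) where

    A : Subset m
    A = B₁ - x

    Goal : Set
    Goal = ∃[ y ] (y ∈ B₂ × y ∉ B₁ × Bases r (A ∪ ⁅ y ⁆))

    New : Fin m → Set
    New y = y ∈ B₂ × y ∉ B₁

    new? : ∀ y → Dec (New y)
    new? y = (y ∈? B₂) ×-dec ¬? (y ∈? B₁)

    ∣A∣≡r-1 : suc ∣ A ∣ ≡ r
    ∣A∣≡r-1 = trans (∣p-x∣ B₁ x∈B₁) ∣B₁∣≡r

    exchanged-size : ∀ {y} → y ∉ B₁ → ∣ A ∪ ⁅ y ⁆ ∣ ≡ r
    exchanged-size {y} y∉B₁ = trans (∣p∪y∣ A y (λ y∈A → y∉B₁ (p─q⊆p B₁ ⁅ x ⁆ y∈A))) ∣A∣≡r-1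

    -- x ∉ B₂, so elements common to B₁ and B₂ survive the removal of x.
    common⊆A : ∀ {w} → w ∈ B₂ → w ∈ B₁ → w ∈ A
    common⊆A w∈B₂ w∈B₁ = x∈p∧x≢y⇒x∈p-y w∈B₁ (λ { refl → x∉B₂ w∈B₂ })

    candidate : ∀ {y} → New y → ¬ 𝓗 (A ∪ ⁅ y ⁆) → Goal
    candidate {y} (y∈B₂ , y∉B₁) ∉𝓗 = y , y∈B₂ , y∉B₁ , exchanged-size y∉B₁ , ∉𝓗

    -- B₂ ∖ B₁ is nonempty, since B₂ is too large to fit into A.
    some-new : ∃ New
    some-new with any? new?
    ... | yes found = found
    ... | no  none  =
      contradiction (subst (_≤ ∣ A ∣) (trans ∣B₂∣≡r (sym ∣A∣≡r-1)) (p⊆q⇒∣p∣≤∣q∣ B₂⊆A)) 1+n≰n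
      where
      B₂⊆A : B₂ ⊆ A
      B₂⊆A {w} w∈B₂ with w ∈? B₁
      ... | yes w∈B₁ = common⊆A w∈B₂ w∈B₁
      ... | no  w∉B₁ = contradiction (w , w∈B₂ , w∉B₁) none

    only-new : ∀ {y₁} → New y₁ → ¬ (∃ λ y → New y × y ≢ y₁) → B₂ ≡ A ∪ ⁅ y₁ ⁆
    only-new {y₁} (y₁∈B₂ , y₁∉B₁) no-other =
      ⊆∧∣≥∣⇒≡ B₂⊆S (≤-reflexive (trans (exchanged-size y₁∉B₁) (sym ∣B₂∣≡r)))
      where
      B₂⊆S : B₂ ⊆ A ∪ ⁅ y₁ ⁆
      B₂⊆S {w} w∈B₂ with w ∈? B₁ | w ≟ᶠ y₁
      ... | yes w∈B₁ | _      = x∈p∪q⁺ (inj₁ (common⊆A w∈B₂ w∈B₁))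
      ... | no  _    | yes refl = x∈p∪q⁺ (inj₂ (x∈⁅x⁆ y₁))
      ... | no  w∉B₁ | no w≢y₁ = contradiction (w , (w∈B₂ , w∉B₁) , w≢y₁) no-other

    -- With two distinct new elements, one of the two exchanges avoids 𝓒 ⊇ 𝓗.
    two-new : ∀ {y₁ y₂} → New y₁ → New y₂ → y₂ ≢ y₁ → Goal
    two-new {y₁} {y₂} new₁@(_ , y₁∉B₁) new₂ y₂≢y₁ with 𝓒? (A ∪ ⁅ y₁ ⁆)
    ... | no  S₁∉𝓒 = candidate new₁ (λ S₁∈𝓗 → S₁∉𝓒 (𝓗⇒𝓒 S₁∈𝓗))
    ... | yes S₁∈𝓒 = candidate new₂ (λ S₂∈𝓗 → y₂≢y₁ (sym (𝓒-separated A y₁∉A S₁∈𝓒 (𝓗⇒𝓒 S₂∈𝓗))))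
      where
      y₁∉A : y₁ ∉ A
      y₁∉A y₁∈A = y₁∉B₁ (p─q⊆p B₁ ⁅ x ⁆ y₁∈A)

    exchange : Goal
    exchange with some-new
    ... | y₁ , new₁ with any? (λ y → new? y ×-dec ¬? (y ≟ᶠ y₁))
    ...   | yes (y₂ , new₂ , y₂≢y₁) = two-new new₁ new₂ y₂≢y₁
    ...   | no  no-other = candidate new₁ (subst (λ S → ¬ 𝓗 S) (only-new new₁ no-other) B₂∉𝓗)

  sparsePaving : ∀ r → ∃ (Bases r) → IsMatroidBases (Bases r)
  sparsePaving r basis = basis , λ B₁ B₂ x (∣B₁∣ , _) (∣B₂∣ , B₂∉𝓗) x∈B₁ x∉B₂ →
    Exchange.exchange ∣B₁∣ ∣B₂∣ B₂∉𝓗 x∈B₁ x∉B₂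

Closed : ∀ {m} → (Fin m → Fin m → Set) → Subset m → Set
Closed _~_ S = ∀ z p → z ~ p → z ∈ S → p ∈ S

closed? : ∀ {m} {_~_ : Fin m → Fin m → Set} → (∀ z p → Dec (z ~ p)) → ∀ S → Dec (Closed _~_ S)
closed? _~?_ S = all? λ z → all? λ p → (z ~? p) →-dec ((z ∈? S) →-dec (p ∈? S))

-- For a symmetric, irreflexive relation in which every element has a
-- neighbour, closed sets are separated: if A ∪ {y₁} is closed, the
-- neighbour of y₁ lies in A, so any closed A ∪ {y₂} must contain y₁.
closed-separated : ∀ {m} {_~_ : Fin m → Fin m → Set} →
  (∀ {a b} → a ~ b → b ~ a) → (∀ {a} → ¬ a ~ a) → (∀ a → ∃ (a ~_)) →
  ∀ A {y₁ y₂} → y₁ ∉ A → Closed _~_ (A ∪ ⁅ y₁ ⁆) → Closed _~_ (A ∪ ⁅ y₂ ⁆) → y₁ ≡ y₂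
closed-separated {_~_ = _~_} ~-sym ~-irrefl ~-total A {y₁} {y₂} y₁∉A closed₁ closed₂
  with ~-total y₁
... | p , y₁~p with x∈p∪q⁻ A ⁅ y₂ ⁆ (closed₂ p y₁ (~-sym y₁~p) (x∈p∪q⁺ (inj₁ p∈A)))
  where
  p∈A : p ∈ A
  p∈A with x∈p∪q⁻ A ⁅ y₁ ⁆ (closed₁ y₁ p y₁~p (x∈p∪q⁺ (inj₂ (x∈⁅x⁆ y₁))))
  ... | inj₁ p∈A  = p∈A
  ... | inj₂ p∈y₁ = contradiction (subst (y₁ ~_) (x∈⁅y⁆⇒x≡y y₁ p∈y₁) y₁~p) ~-irrefl
...   | inj₁ y₁∈A  = contradiction y₁∈A y₁∉A
...   | inj₂ y₁∈y₂ = x∈⁅y⁆⇒x≡y y₂ y₁∈y₂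

-- The pairing involution on indices: 2i ↔ 2i+1, i.e. on labels 2i+1 ↔ 2i+2.
mate : ℕ → ℕ
mate zero          = 1
mate (suc zero)    = 0
mate (suc (suc a)) = suc (suc (mate a))

mate-involutive : ∀ a → mate (mate a) ≡ a
mate-involutive zero          = refl
mate-involutive (suc zero)    = refl
mate-involutive (suc (suc a)) = cong (λ t → suc (suc t)) (mate-involutive a)

mate-no-fixed-point : ∀ a → mate a ≢ a
mate-no-fixed-point zero ()
mate-no-fixed-point (suc zero) ()
mate-no-fixed-point (suc (suc a)) e = mate-no-fixed-point a (suc-injective (suc-injective e))

mate-< : ∀ k a → a < k + k → mate a < k + k
mate-< (suc k) zero          _ rewrite +-suc k k = s≤s (s≤s z≤n)
mate-< (suc k) (suc zero)    _ = s≤s z≤n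
mate-< (suc k) (suc (suc a)) a<2k rewrite +-suc k k =
  s≤s (s≤s (mate-< k a (≤-pred (≤-pred a<2k))))

Mates : ∀ {m} → Fin m → Fin m → Set
Mates z p = toℕ p ≡ mate (toℕ z)

mates? : ∀ {m} (z p : Fin m) → Dec (Mates z p)
mates? z p = toℕ p ≟ mate (toℕ z)

mates-sym : ∀ {m} {z p : Fin m} → Mates z p → Mates p z
mates-sym {z = z} z~p = trans (sym (mate-involutive (toℕ z))) (cong mate (sym z~p))

mates-irrefl : ∀ {m} {z : Fin m} → ¬ Mates z z
mates-irrefl {z = z} z~z = mate-no-fixed-point (toℕ z) (sym z~z)

mates-total : ∀ n (z : Fin (2 * n)) → ∃ (Mates z)
mates-total n z = fromℕ< mate<2n , toℕ-fromℕ< mate<2n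
  where
  2n≡n+n : 2 * n ≡ n + n
  2n≡n+n = cong (n +_) (+-identityʳ n)
  mate<2n : mate (toℕ z) < 2 * n
  mate<2n = subst (mate (toℕ z) <_) (sym 2n≡n+n)
              (mate-< n (toℕ z) (subst (toℕ z <_) 2n≡n+n (toℕ<n z)))

mate-even : ∀ i → mate (2 * i) ≡ suc (2 * i)
mate-even zero    = refl
mate-even (suc i) rewrite +-suc i (i + 0) = cong (λ t → suc (suc t)) (mate-even i)

mate-odd : ∀ i → mate (suc (2 * i)) ≡ 2 * i
mate-odd zero    = refl
mate-odd (suc i) rewrite +-suc i (i + 0) = cong (λ t → suc (suc t)) (mate-odd i)

MateClosedLabels : List ℕ → Set
MateClosedLabels l = ∀ a → suc a ∈ₗ l → suc (mate a) ∈ₗ l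

hasLabels⇒closed : ∀ {m} {S : Subset m} {l} → HasLabels S l → MateClosedLabels l → Closed Mates S
hasLabels⇒closed {l = l} S≃l l-closed z p z~p z∈S =
  Equivalence.from (S≃l p)
    (subst (λ t → suc t ∈ₗ l) (sym z~p) (l-closed (toℕ z) (Equivalence.to (S≃l z) z∈S)))

twoPairs : ℕ → ℕ → List ℕ
twoPairs i j = suc (2 * i) ∷ suc (suc (2 * i)) ∷ suc (2 * j) ∷ suc (suc (2 * j)) ∷ []

twoPairs-closed : ∀ i j → MateClosedLabels (twoPairs i j)
twoPairs-closed i j a (here refl) rewrite mate-even i = there (here refl)
twoPairs-closed i j a (there (here refl)) rewrite mate-odd i = here refl
twoPairs-closed i j a (there (there (here refl))) rewrite mate-even j = there (there (there (here refl)))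
twoPairs-closed i j a (there (there (there (here refl)))) rewrite mate-odd j = there (there (here refl))

double-suc : ∀ i → 2 * suc i ≡ suc (suc (2 * i))
double-suc i = cong suc (+-suc i (i + 0))

pairs-1-2-and : ∀ k → (1 ∷ 2 ∷ (2 * suc k ∸ 1) ∷ (2 * suc k) ∷ []) ≡ twoPairs 0 k
pairs-1-2-and k = cong (λ t → 1 ∷ 2 ∷ (t ∸ 1) ∷ t ∷ []) (double-suc k)

consecutive-pairs : ∀ k →
  ((2 * suc k ∸ 1) ∷ (2 * suc k) ∷ (2 * suc k + 1) ∷ (2 * suc k + 2) ∷ []) ≡ twoPairs k (suc k)
consecutive-pairs k =
  cong₂ _∷_ (cong (_∸ 1) (double-suc k))
  (cong₂ _∷_ (double-suc k)
  (cong₂ _∷_ (+-comm (2 * suc k) 1)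
  (cong₂ _∷_ (+-comm (2 * suc k) 2) refl)))

InH⇒closed : ∀ n {S} → InH n S → Closed Mates S
InH⇒closed n {S} (suc k , _ , _ , inj₁ S≃l) =
  hasLabels⇒closed (subst (HasLabels S) (pairs-1-2-and k) S≃l) (twoPairs-closed 0 k)
InH⇒closed n {S} (suc k , _ , _ , inj₂ (_ , S≃l)) =
  hasLabels⇒closed (subst (HasLabels S) (consecutive-pairs k) S≃l) (twoPairs-closed k (suc k))

-- {1,2,3,5} contains the label 3 but not its mate 4, so it is a 4-set that
-- is not closed under Mates.
nonClosedQuadruple : ∀ {m} → 5 ≤ m → ∃ λ (B : Subset m) → ∣ B ∣ ≡ 4 × ¬ Closed Mates B
nonClosedQuadruple {suc (suc (suc (suc (suc r))))} (s≤s (s≤s (s≤s (s≤s (s≤s _))))) =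
  B , cong (4 +_) (∣⊥∣≡0 r) , λ closed → label4∉B (closed label3 label4 refl label3∈B)
  where
  B : Subset (5 + r)
  B = inside ∷ inside ∷ inside ∷ outside ∷ inside ∷ ⊥
  label3 label4 : Fin (5 + r)
  label3 = Fin.suc (Fin.suc Fin.zero)
  label4 = Fin.suc (Fin.suc (Fin.suc Fin.zero))
  label3∈B : label3 ∈ B
  label3∈B = there (there here)
  label4∉B : label4 ∉ B
  label4∉B (there (there (there ())))

vamosBasis : ∀ n → 4 ≤ n → ∃ (VamosBases n)
vamosBasis n 4≤n with nonClosedQuadruple (≤-trans (s≤s (s≤s (s≤s (s≤s (s≤s z≤n))))) (*-monoʳ-≤ 2 4≤n))
... | B , ∣B∣≡4 , B-open = B , ∣B∣≡4 , λ B∈𝓗 → B-open (InH⇒closed n B∈𝓗)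

proposition3p2 : (n : ℕ) → 4 ≤ n → IsMatroidBases (VamosBases n)
proposition3p2 n 4≤n = sparsePaving 4 (vamosBasis n 4≤n)
  where
  open SparsePaving (InH n) (Closed Mates) (closed? mates?) (InH⇒closed n)
         (closed-separated mates-sym mates-irrefl (mates-total n))
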